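{- Let $p$ be a prime number and let $G$ be a bipartite graph. Then every strongly $p$-uniform integer additive set-indexer of $G$ is also a weakly $p$-uniform integer additive set-indexer of $G$.
   Context: All graphs are simple, finite and have no isolated vertices. Set-labels are non-empty finite subsets of the non-negative integers $\mathbb{N}_0$. For sets $A,B$, $A+B=\{a+b: a\in A, b\in B\}$. An integer additive set-indexer (IASI) of $G$ is an injective $f:V(G)\to 2^{\mathbb{N}_0}$ such that $f^+:E(G)\to 2^{\mathbb{N}_0}$, $f^+(uv)=f(u)+f(v)$, is injective. An IASI is $k$-uniform if $|f^+(e)|=k$ for all edges $e$. It is strong if $|f^+(uv)|=|f(u)|\,|f(v)|$ for every edge $uv$, and strongly $k$-uniform if it is strong and $k$-uniform. It is weak if $|f^+(uv)|=\max(|f(u)|,|f(v)|)$ for every edge $uv$, and weakly $k$-uniform if it is weak and $k$-uniform. -}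

module Defs where

open import Data.Nat using (ℕ; _+_; _*_; _⊔_)
open import Data.Nat.Properties using (_≟_)
open import Data.Fin using (Fin) renaming (_<_ to _<ᶠ_)
open import Data.Bool using (Bool)
open import Data.List using (List; []; _∷_; length; map; concatMap; deduplicate)
open import Data.List.Membership.Propositional using (_∈_)
open import Data.Product using (Σ; ∃; ∃-syntax; _×_)
open import Relation.Nullary using (¬_)
open import Relation.Binary.PropositionalEquality using (_≡_; _≢_)

-- Finite subsets of ℕ₀ are represented by lists (order and repetitions irrelevant).
FinSet : Set
FinSet = List ℕ

_≈ˢ_ : FinSet → FinSet → Set
A ≈ˢ B = ∀ x → (x ∈ A → x ∈ B) × (x ∈ B → x ∈ A)

card : FinSet → ℕ
card A = length (deduplicate _≟_ A)

NonEmpty : FinSet → Set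
NonEmpty A = ∃[ a ] (a ∈ A)

_⊕_ : FinSet → FinSet → FinSet
A ⊕ B = concatMap (λ a → map (a +_) B) A

record Graph : Set₁ where
  field
    n        : ℕ
    Adj      : Fin n → Fin n → Set
    sym      : ∀ {u v} → Adj u v → Adj v u
    irrefl   : ∀ {u} → ¬ Adj u u
    noIsolated : ∀ u → ∃[ v ] Adj u v

open Graph public

Bipartite : Graph → Set
Bipartite G = Σ (Fin (n G) → Bool) λ c → ∀ {u v} → Adj G u v → c u ≢ c v

Labelling : Graph → Set
Labelling G = Fin (n G) → FinSet

edgeLabel : (G : Graph) → Labelling G → Fin (n G) → Fin (n G) → FinSet
edgeLabel G f u v = f u ⊕ f v

-- An edge uv is represented by its endpoints with u < v (unordered pair).
record IASI (G : Graph) (f : Labelling G) : Set where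
  field
    nonEmpty : ∀ u → NonEmpty (f u)
    injective : ∀ u v → f u ≈ˢ f v → u ≡ v
    edgeInjective : ∀ u v u' v' → u <ᶠ v → Adj G u v → u' <ᶠ v' → Adj G u' v' →
                    edgeLabel G f u v ≈ˢ edgeLabel G f u' v' → (u ≡ u' × v ≡ v')

Uniform : (G : Graph) → ℕ → Labelling G → Set
Uniform G k f = ∀ u v → Adj G u v → card (edgeLabel G f u v) ≡ k

Strong : (G : Graph) → Labelling G → Set
Strong G f = ∀ u v → Adj G u v → card (edgeLabel G f u v) ≡ card (f u) * card (f v)

Weak : (G : Graph) → Labelling G → Set
Weak G f = ∀ u v → Adj G u v → card (edgeLabel G f u v) ≡ card (f u) ⊔ card (f v)

StronglyUniformIASI : (G : Graph) → ℕ → Labelling G → Set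
StronglyUniformIASI G k f = IASI G f × Strong G f × Uniform G k f

WeaklyUniformIASI : (G : Graph) → ℕ → Labelling G → Set
WeaklyUniformIASI G k f = IASI G f × Weak G f × Uniform G k f

-- On an edge uv, strongness and p-uniformity give |f u| · |f v| = p, so by primality one
-- factor is 1 and the product equals the maximum; this is exactly weakness.
module Submission where

open import Defs hiding (sym)
open import Data.Nat.Base using (ℕ; _*_; _⊔_; NonZero; >-nonZero⁻¹)
open import Data.Nat.Divisibility using (m∣m*n)
open import Data.Nat.Primality using (Prime; prime⇒irreducible; prime⇒nonZero)
open import Data.Nat.Properties
  using (*-identityˡ; *-identityʳ; *-cancelˡ-≡; m*n≢0⇒m≢0; m*n≢0⇒n≢0; m≤n⇒m⊔n≡n; m≥n⇒m⊔n≡m)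
open import Data.Product using (_,_)
open import Data.Sum using (_⊎_; inj₁; inj₂)
open import Relation.Binary.PropositionalEquality using (_≡_; refl; sym; trans; subst)

prime-product⇒factor≡1 : ∀ m n → Prime (m * n) → m ≡ 1 ⊎ n ≡ 1
prime-product⇒factor≡1 m n pr with prime⇒irreducible pr (m∣m*n n)
... | inj₁ m≡1   = inj₁ m≡1
... | inj₂ m≡m*n = inj₂ (sym (*-cancelˡ-≡ 1 n m (trans (*-identityʳ m) m≡m*n)))
  where instance _ = m*n≢0⇒m≢0 m {{prime⇒nonZero pr}}

*≡⊔-if-factor≡1 : ∀ m n .{{_ : NonZero m}} .{{_ : NonZero n}} → m ≡ 1 ⊎ n ≡ 1 → m * n ≡ m ⊔ n
*≡⊔-if-factor≡1 m n (inj₁ refl) = trans (*-identityˡ n) (sym (m≤n⇒m⊔n≡n (>-nonZero⁻¹ n)))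
*≡⊔-if-factor≡1 m n (inj₂ refl) = trans (*-identityʳ m) (sym (m≥n⇒m⊔n≡m (>-nonZero⁻¹ m)))

prime-product⇒*≡⊔ : ∀ m n → Prime (m * n) → m * n ≡ m ⊔ n
prime-product⇒*≡⊔ m n pr = *≡⊔-if-factor≡1 m n (prime-product⇒factor≡1 m n pr)
  where
  instance
    _ = m*n≢0⇒m≢0 m {{prime⇒nonZero pr}}
    _ = m*n≢0⇒n≢0 m {{prime⇒nonZero pr}}

strong-prime-uniform⇒weak : ∀ {p} G f → Prime p → Strong G f → Uniform G p f → Weak G f
strong-prime-uniform⇒weak G f pp strong uniform u v adj =
  trans (strong u v adj) (prime-product⇒*≡⊔ (card (f u)) (card (f v)) prime-product)
  where
  prime-product : Prime (card (f u) * card (f v))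
  prime-product = subst Prime (trans (sym (uniform u v adj)) (strong u v adj)) pp

corollary2 : (p : ℕ) → Prime p → (G : Graph) → Bipartite G →
    (f : Labelling G) → StronglyUniformIASI G p f → WeaklyUniformIASI G p f
corollary2 p pp G _ f (iasi , strong , uniform) =
  iasi , strong-prime-uniform⇒weak G f pp strong uniform , uniform
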